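{- Let $p$ be a prime. For every nonnegative integer $i$ and every digit $a\in\{0,1,\dots,p-1\}$, there exists a polynomial $\Psi_{i,a}$ with integer coefficients such that $\psi_i(px+a)=\psi_{i+1}(x)\Psi_{i,a}(x)$ for all nonnegative integers $x$.
   Context: For a positive integer $z$, $\Theta_p(z)$ is defined by $z=p^{\nu_p(z)}\Theta_p(z)$, where $\nu_p(z)$ is the exponent of $p$ in $z$. For nonnegative integers $i,x$, $\psi_i(x)=\Theta_p((p^ix)!)$ (with $0!=1$). -}

module Defs where

open import Data.Nat using (ℕ; zero; suc; _*_; _^_; NonZero; _!)
open import Data.Nat.DivMod using (_/_)
open import Data.Nat.Divisibility using (_∣?_)
open import Data.Integer as ℤ using (ℤ)
open import Data.List using (List; []; _∷_)
open import Relation.Nullary using (yes; no)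

-- Divide out the factor p repeatedly, with `fuel` steps available.
-- With fuel ≥ ν_p(z) (e.g. fuel = z for z ≥ 1) this returns Θ_p(z).
strip : (p : ℕ) .{{_ : NonZero p}} → ℕ → ℕ → ℕ
strip p zero     z = z
strip p (suc f)  z with p ∣? z
... | yes _ = strip p f (z / p)
... | no  _ = z

-- Θ_p(z): the p-free part of z, i.e. z = p^{ν_p(z)} Θ_p(z).
-- (Only meaningful for z ≥ 1; z ≥ 1 gives enough fuel since ν_p(z) ≤ z.)
Θ : (p : ℕ) .{{_ : NonZero p}} → ℕ → ℕ
Θ p z = strip p z z

ψ : (p : ℕ) .{{_ : NonZero p}} → ℕ → ℕ → ℕ
ψ p i x = Θ p ((p ^ i * x) !)

-- Polynomials with integer coefficients as coefficient lists
-- (constant term first); evaluation by Horner's rule.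
Poly : Set
Poly = List ℤ

eval : Poly → ℤ → ℤ
eval []       t = ℤ.0ℤ
eval (c ∷ cs) t = c ℤ.+ t ℤ.* eval cs t

module Submission where

-- Since p ^ i * (p * x + a) = p ^ (i + 1) * x + p ^ i * a, the factorial on the left is
-- (p ^ (i + 1) * x)! times the factors p ^ (i + 1) * x + k for 0 < k ≤ p ^ i * a < p ^ (i + 1).
-- Writing k = p ^ v * m with p ∤ m, we have v < i + 1, so the p-free part of such a factor is
-- m + p ^ (i + 1 - v) * x, linear in x. As Θ_p is multiplicative, Ψ is the product of these
-- linear polynomials.

open import Defs
open import Data.Nat using (ℕ; _+_; _*_; _<_; NonZero)
open import Data.Nat.Primality using (Prime)
open import Data.Integer using (+_) renaming (_*_ to _*ℤ_)
open import Data.Product using (Σ)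
open import Relation.Binary.PropositionalEquality using (_≡_)

open import Data.Nat using (zero; suc; _∸_; _^_; _!; _≤_; z≤n; s≤s; s≤s⁻¹; z<s; ≢-nonZero; >-nonZero⁻¹; nonTrivial⇒n>1)
open import Data.Nat.Properties
open import Data.Nat.Primality using (euclidsLemma; prime⇒nonTrivial)
open import Data.Nat.Divisibility using (_∣_; divides; _∣?_; _∣0; ∣m+n∣m⇒∣n; m∣m*n)
open import Data.Nat.DivMod using (_/_; m*n/n≡m)
open import Data.Nat.Induction using (<-wellFounded)
open import Data.Nat.Tactic.RingSolver as ℕ-Solver using ()
open import Data.Integer using (ℤ; 0ℤ) renaming (_+_ to _+ℤ_)
import Data.Integer.Properties as ℤ
open import Data.Integer.Tactic.RingSolver as ℤ-Solver using ()
open import Data.List using ([]; _∷_)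
open import Data.Product using (_,_; _×_)
open import Data.Sum using (inj₁; inj₂)
open import Induction.WellFounded using (Acc; acc)
open import Relation.Nullary using (¬_; yes; no; contradiction)
open import Function using (_∘_)
open import Relation.Binary.PropositionalEquality using (refl; sym; trans; cong; cong₂; subst; module ≡-Reasoning)

infixl 6 _⊕_
infixl 7 _⊛_ _⊗_

_⊛_ : ℤ → Poly → Poly
c ⊛ []      = []
c ⊛ (d ∷ Q) = c *ℤ d ∷ c ⊛ Q

_⊕_ : Poly → Poly → Poly
[]      ⊕ Q       = Q
(c ∷ P) ⊕ []      = c ∷ P
(c ∷ P) ⊕ (d ∷ Q) = c +ℤ d ∷ P ⊕ Q

_⊗_ : Poly → Poly → Poly
[]      ⊗ Q = []
(c ∷ P) ⊗ Q = c ⊛ Q ⊕ (0ℤ ∷ P ⊗ Q)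

eval-⊛ : ∀ c Q t → eval (c ⊛ Q) t ≡ c *ℤ eval Q t
eval-⊛ c []      t = sym (ℤ.*-zeroʳ c)
eval-⊛ c (d ∷ Q) t = begin
  c *ℤ d +ℤ t *ℤ eval (c ⊛ Q) t   ≡⟨ cong (λ e → c *ℤ d +ℤ t *ℤ e) (eval-⊛ c Q t) ⟩
  c *ℤ d +ℤ t *ℤ (c *ℤ eval Q t)  ≡⟨ shuffle c d t (eval Q t) ⟩
  c *ℤ (d +ℤ t *ℤ eval Q t)       ∎
  where
  open ≡-Reasoning
  shuffle : ∀ c d t e → c *ℤ d +ℤ t *ℤ (c *ℤ e) ≡ c *ℤ (d +ℤ t *ℤ e)
  shuffle = ℤ-Solver.solve-∀

eval-⊕ : ∀ P Q t → eval (P ⊕ Q) t ≡ eval P t +ℤ eval Q t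
eval-⊕ []      Q       t = sym (ℤ.+-identityˡ (eval Q t))
eval-⊕ (c ∷ P) []      t = sym (ℤ.+-identityʳ (eval (c ∷ P) t))
eval-⊕ (c ∷ P) (d ∷ Q) t = begin
  c +ℤ d +ℤ t *ℤ eval (P ⊕ Q) t               ≡⟨ cong (λ e → c +ℤ d +ℤ t *ℤ e) (eval-⊕ P Q t) ⟩
  c +ℤ d +ℤ t *ℤ (eval P t +ℤ eval Q t)       ≡⟨ shuffle c d t (eval P t) (eval Q t) ⟩
  c +ℤ t *ℤ eval P t +ℤ (d +ℤ t *ℤ eval Q t)  ∎
  where
  open ≡-Reasoning
  shuffle : ∀ c d t e f → c +ℤ d +ℤ t *ℤ (e +ℤ f) ≡ c +ℤ t *ℤ e +ℤ (d +ℤ t *ℤ f)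
  shuffle = ℤ-Solver.solve-∀

eval-⊗ : ∀ P Q t → eval (P ⊗ Q) t ≡ eval P t *ℤ eval Q t
eval-⊗ []      Q t = refl
eval-⊗ (c ∷ P) Q t = begin
  eval (c ⊛ Q ⊕ (0ℤ ∷ P ⊗ Q)) t                         ≡⟨ eval-⊕ (c ⊛ Q) (0ℤ ∷ P ⊗ Q) t ⟩
  eval (c ⊛ Q) t +ℤ (0ℤ +ℤ t *ℤ eval (P ⊗ Q) t)         ≡⟨ cong₂ (λ a b → a +ℤ (0ℤ +ℤ t *ℤ b)) (eval-⊛ c Q t) (eval-⊗ P Q t) ⟩
  c *ℤ eval Q t +ℤ (0ℤ +ℤ t *ℤ (eval P t *ℤ eval Q t))  ≡⟨ shuffle c t (eval P t) (eval Q t) ⟩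
  (c +ℤ t *ℤ eval P t) *ℤ eval Q t                      ∎
  where
  open ≡-Reasoning
  shuffle : ∀ c t e f → c *ℤ f +ℤ (0ℤ +ℤ t *ℤ (e *ℤ f)) ≡ (c +ℤ t *ℤ e) *ℤ f
  shuffle = ℤ-Solver.solve-∀

Polynomial : (ℕ → ℕ) → Set
Polynomial f = Σ Poly λ Ψ → ∀ x → + f x ≡ eval Ψ (+ x)

infix 4 _∣[x]_

record _∣[x]_ (f g : ℕ → ℕ) : Set where
  constructor _,_
  field
    quotient     : Poly
    g≡f*quotient : ∀ x → + g x ≡ (+ f x) *ℤ eval quotient (+ x)

open _∣[x]_

linear-polynomial : ∀ c₀ c₁ → Polynomial (λ x → c₀ + c₁ * x)
linear-polynomial c₀ c₁ = + c₀ ∷ + c₁ ∷ [] , λ x → begin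
  + (c₀ + c₁ * x)                     ≡⟨ ℤ.pos-+ c₀ (c₁ * x) ⟩
  + c₀ +ℤ + (c₁ * x)                  ≡⟨ cong (_+ℤ_ (+ c₀)) (ℤ.pos-* c₁ x) ⟩
  + c₀ +ℤ + c₁ *ℤ + x                 ≡⟨ shuffle (+ c₀) (+ c₁) (+ x) ⟩
  + c₀ +ℤ + x *ℤ (+ c₁ +ℤ + x *ℤ 0ℤ)  ∎
  where
  open ≡-Reasoning
  shuffle : ∀ a b t → a +ℤ b *ℤ t ≡ a +ℤ t *ℤ (b +ℤ t *ℤ 0ℤ)
  shuffle = ℤ-Solver.solve-∀

Polynomial-cong : ∀ {f g} → (∀ x → f x ≡ g x) → Polynomial f → Polynomial g
Polynomial-cong f≗g (Ψ , f≡Ψ) = Ψ , λ x → trans (cong +_ (sym (f≗g x))) (f≡Ψ x)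

∣[x]-refl : ∀ {f} → f ∣[x] f
∣[x]-refl {f} = + 1 ∷ [] , λ x → sym (identity (+ f x) (+ x))
  where
  identity : ∀ a t → a *ℤ (+ 1 +ℤ t *ℤ 0ℤ) ≡ a
  identity = ℤ-Solver.solve-∀

∣[x]-cong : ∀ {f g h} → (∀ x → g x ≡ h x) → f ∣[x] g → f ∣[x] h
∣[x]-cong g≗h (Ψ , g≡fΨ) = Ψ , λ x → trans (cong +_ (sym (g≗h x))) (g≡fΨ x)

∣[x]-*ˡ : ∀ {f g h} → Polynomial h → f ∣[x] g → f ∣[x] (λ x → h x * g x)
∣[x]-*ˡ {f} {g} {h} (Φ , h≡Φ) (Ψ , g≡fΨ) = Φ ⊗ Ψ , λ x → begin
  + (h x * g x)                            ≡⟨ ℤ.pos-* (h x) (g x) ⟩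
  + h x *ℤ + g x                           ≡⟨ cong₂ _*ℤ_ (h≡Φ x) (g≡fΨ x) ⟩
  eval Φ (+ x) *ℤ (+ f x *ℤ eval Ψ (+ x))  ≡⟨ shuffle (eval Φ (+ x)) (+ f x) (eval Ψ (+ x)) ⟩
  + f x *ℤ (eval Φ (+ x) *ℤ eval Ψ (+ x))  ≡⟨ cong (+ f x *ℤ_) (sym (eval-⊗ Φ Ψ (+ x))) ⟩
  + f x *ℤ eval (Φ ⊗ Ψ) (+ x)              ∎
  where
  open ≡-Reasoning
  shuffle : ∀ a b c → a *ℤ (b *ℤ c) ≡ b *ℤ (a *ℤ c)
  shuffle = ℤ-Solver.solve-∀

n<m^n : ∀ {m} → 1 < m → ∀ n → n < m ^ n
n<m^n             1<m zero    = s≤s z≤n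
n<m^n {m@(suc _)} 1<m (suc n) = begin-strict
  suc n      ≤⟨ n<m^n 1<m n ⟩
  m ^ n      <⟨ m<m*n (m ^ n) m {{m^n≢0 m n}} 1<m ⟩
  m ^ n * m  ≡⟨ *-comm (m ^ n) m ⟩
  m ^ suc n  ∎
  where open ≤-Reasoning

module _ (p : ℕ) .{{_ : NonZero p}} (1<p : 1 < p) where

  Splitting : ℕ → Set
  Splitting z = Σ ℕ λ v → Σ ℕ λ m → z ≡ p ^ v * m × ¬ p ∣ m

  splitting : ∀ z → 0 < z → Splitting z
  splitting z 0<z = go z 0<z (<-wellFounded z)
    where
    go : ∀ z → 0 < z → Acc _<_ z → Splitting z
    go z 0<z (acc rec) with p ∣? z
    ... | no p∤z = 0 , z , sym (*-identityˡ z) , p∤z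
    go .(0 * p) () _ | yes (divides zero refl)
    go .(q * p) _ (acc rec) | yes (divides q@(suc _) refl) with go q z<s (rec (m<m*n q p 1<p))
    ... | v , m , q≡ , p∤m = suc v , m , trans (cong (_* p) q≡) (reassoc (p ^ v) m p) , p∤m
      where
      reassoc : ∀ a b c → a * b * c ≡ c * a * b
      reassoc = ℕ-Solver.solve-∀

  strip-p^v*m : ∀ f v {m z} → z ≡ p ^ v * m → ¬ p ∣ m → v ≤ f → strip p f z ≡ m
  strip-p^v*m zero    zero    {m} refl _ _ = *-identityˡ m
  strip-p^v*m (suc f) v       {m} {z} z≡ p∤m v≤f with p ∣? z
  strip-p^v*m (suc f) zero    {m} refl p∤m _   | yes p∣m = contradiction (subst (p ∣_) (*-identityˡ m) p∣m) p∤m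
  strip-p^v*m (suc f) zero    {m} refl _   _   | no _    = *-identityˡ m
  strip-p^v*m (suc f) (suc v) {m} refl p∤m v≤f | yes _   =
    strip-p^v*m f v p^[1+v]*m/p≡p^v*m p∤m (s≤s⁻¹ v≤f)
    where
    p^[1+v]*m/p≡p^v*m : p ^ suc v * m / p ≡ p ^ v * m
    p^[1+v]*m/p≡p^v*m = trans (cong (_/ p) (trans (*-assoc p (p ^ v) m) (*-comm p (p ^ v * m))))
                              (m*n/n≡m (p ^ v * m) p)
  strip-p^v*m (suc f) (suc v) {m} refl _   _   | no p∤z  =
    contradiction (subst (p ∣_) (sym (*-assoc p (p ^ v) m)) (m∣m*n (p ^ v * m))) p∤z

  -- Θ runs strip with fuel p ^ v * m, and v < p ^ v ≤ p ^ v * m.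
  Θ-p^v*m : ∀ v {m} → ¬ p ∣ m → Θ p (p ^ v * m) ≡ m
  Θ-p^v*m v {zero}      p∤0 = contradiction (p ∣0) p∤0
  Θ-p^v*m v {m@(suc _)} p∤m = strip-p^v*m (p ^ v * m) v refl p∤m
    (≤-trans (<⇒≤ (n<m^n 1<p v)) (m≤m*n (p ^ v) m))

  Θ-* : Prime p → ∀ {a b} → 0 < a → 0 < b → Θ p (a * b) ≡ Θ p a * Θ p b
  Θ-* p-prime {a} {b} 0<a 0<b with splitting a 0<a | splitting b 0<b
  ... | u , m , refl , p∤m | v , n , refl , p∤n = begin
    Θ p (p ^ u * m * (p ^ v * n))      ≡⟨ cong (Θ p) (regroup (p ^ u) m (p ^ v) n) ⟩
    Θ p (p ^ u * p ^ v * (m * n))      ≡⟨ cong (λ q → Θ p (q * (m * n))) (sym (^-distribˡ-+-* p u v)) ⟩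
    Θ p (p ^ (u + v) * (m * n))        ≡⟨ Θ-p^v*m (u + v) p∤mn ⟩
    m * n                              ≡⟨ sym (cong₂ _*_ (Θ-p^v*m u p∤m) (Θ-p^v*m v p∤n)) ⟩
    Θ p (p ^ u * m) * Θ p (p ^ v * n)  ∎
    where
    open ≡-Reasoning
    regroup : ∀ a b c d → a * b * (c * d) ≡ a * c * (b * d)
    regroup = ℕ-Solver.solve-∀
    p∤mn : ¬ p ∣ m * n
    p∤mn p∣mn with euclidsLemma m n p-prime p∣mn
    ... | inj₁ p∣m = p∤m p∣m
    ... | inj₂ p∣n = p∤n p∣n

  Θ[p^j*x+k]-polynomial : ∀ j {k} → 0 < k → k < p ^ j → Polynomial (λ x → Θ p (p ^ j * x + k))
  Θ[p^j*x+k]-polynomial j {k} 0<k k<p^j with splitting k 0<k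
  ... | v , m , refl , p∤m = Polynomial-cong linear≡Θ (linear-polynomial m (p ^ suc e))
    where
    v<j : v < j
    v<j = ≰⇒> λ j≤v → <⇒≱ k<p^j (≤-trans (^-monoʳ-≤ p j≤v) (m≤m*n (p ^ v) m {{m≢0}}))
      where
      m≢0 : NonZero m
      m≢0 = ≢-nonZero λ { refl → p∤m (p ∣0) }
    e : ℕ
    e = j ∸ suc v
    j≡v+[1+e] : j ≡ v + suc e
    j≡v+[1+e] = sym (trans (+-suc v e) (m+[n∸m]≡n v<j))
    factor : ∀ x → p ^ j * x + p ^ v * m ≡ p ^ v * (p ^ suc e * x + m)
    factor x = begin
      p ^ j * x + p ^ v * m              ≡⟨ cong (λ q → q * x + p ^ v * m) (cong (p ^_) j≡v+[1+e]) ⟩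
      p ^ (v + suc e) * x + p ^ v * m    ≡⟨ cong (λ q → q * x + p ^ v * m) (^-distribˡ-+-* p v (suc e)) ⟩
      p ^ v * p ^ suc e * x + p ^ v * m  ≡⟨ distrib (p ^ v) (p ^ suc e) x m ⟩
      p ^ v * (p ^ suc e * x + m)        ∎
      where
      open ≡-Reasoning
      distrib : ∀ a b c d → a * b * c + a * d ≡ a * (b * c + d)
      distrib = ℕ-Solver.solve-∀
    p∤p^[1+e]*x+m : ∀ x → ¬ p ∣ p ^ suc e * x + m
    p∤p^[1+e]*x+m x p∣ = p∤m (∣m+n∣m⇒∣n p∣ (subst (p ∣_) (sym (*-assoc p (p ^ e) x)) (m∣m*n (p ^ e * x))))
    linear≡Θ : ∀ x → m + p ^ suc e * x ≡ Θ p (p ^ j * x + p ^ v * m)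
    linear≡Θ x = begin
      m + p ^ suc e * x                  ≡⟨ +-comm m (p ^ suc e * x) ⟩
      p ^ suc e * x + m                  ≡⟨ Θ-p^v*m v (p∤p^[1+e]*x+m x) ⟨
      Θ p (p ^ v * (p ^ suc e * x + m))  ≡⟨ cong (Θ p) (factor x) ⟨
      Θ p (p ^ j * x + p ^ v * m)        ∎
      where open ≡-Reasoning

  Θ[p^j*x]!∣[x]Θ[p^j*x+K]! : Prime p → ∀ j K → K < p ^ j →
    (λ x → Θ p ((p ^ j * x) !)) ∣[x] (λ x → Θ p ((p ^ j * x + K) !))
  Θ[p^j*x]!∣[x]Θ[p^j*x+K]! _ j zero _ =
    ∣[x]-cong (λ x → cong (Θ p ∘ _!) (sym (+-identityʳ (p ^ j * x)))) ∣[x]-refl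
  Θ[p^j*x]!∣[x]Θ[p^j*x+K]! p-prime j (suc K) 1+K<p^j =
    ∣[x]-cong Θ-factorial-step
      (∣[x]-*ˡ (Θ[p^j*x+k]-polynomial j z<s 1+K<p^j)
               (Θ[p^j*x]!∣[x]Θ[p^j*x+K]! p-prime j K (<-trans (n<1+n K) 1+K<p^j)))
    where
    Θ-factorial-step : ∀ x → Θ p (p ^ j * x + suc K) * Θ p ((p ^ j * x + K) !) ≡ Θ p ((p ^ j * x + suc K) !)
    Θ-factorial-step x = begin
      Θ p (p ^ j * x + suc K) * Θ p (n !)  ≡⟨ cong (λ q → Θ p q * Θ p (n !)) (+-suc (p ^ j * x) K) ⟩
      Θ p (suc n) * Θ p (n !)              ≡⟨ Θ-* p-prime z<s (>-nonZero⁻¹ (n !) {{n !≢0}}) ⟨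
      Θ p (suc n !)                        ≡⟨ cong (Θ p ∘ _!) (+-suc (p ^ j * x) K) ⟨
      Θ p ((p ^ j * x + suc K) !)          ∎
      where
      open ≡-Reasoning
      n : ℕ
      n = p ^ j * x + K

lemma7 : (p : ℕ) .{{_ : NonZero p}} → Prime p →
         (i a : ℕ) → a < p →
         Σ Poly (λ Ψ → (x : ℕ) →
           + ψ p i (p * x + a) ≡ (+ ψ p (i + 1) x) *ℤ eval Ψ (+ x))
lemma7 p p-prime i a a<p = quotient ψ[i+1]∣ψ[i] , g≡f*quotient ψ[i+1]∣ψ[i]
  where
  p^[i+1]≡p^i*p : p ^ (i + 1) ≡ p ^ i * p
  p^[i+1]≡p^i*p = trans (^-distribˡ-+-* p i 1) (cong (p ^ i *_) (*-identityʳ p))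
  p^i*a<p^[i+1] : p ^ i * a < p ^ (i + 1)
  p^i*a<p^[i+1] = subst (p ^ i * a <_) (sym p^[i+1]≡p^i*p) (*-monoʳ-< (p ^ i) {{m^n≢0 p i}} a<p)
  p^i*[p*x+a] : ∀ x → p ^ i * (p * x + a) ≡ p ^ (i + 1) * x + p ^ i * a
  p^i*[p*x+a] x = begin
    p ^ i * (p * x + a)          ≡⟨ expand (p ^ i) p x a ⟩
    p ^ i * p * x + p ^ i * a    ≡⟨ cong (λ q → q * x + p ^ i * a) p^[i+1]≡p^i*p ⟨
    p ^ (i + 1) * x + p ^ i * a  ∎
    where
    open ≡-Reasoning
    expand : ∀ b c d e → b * (c * d + e) ≡ b * c * d + b * e
    expand = ℕ-Solver.solve-∀
  ψ[i+1]∣ψ[i] : ψ p (i + 1) ∣[x] (λ x → ψ p i (p * x + a))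
  ψ[i+1]∣ψ[i] = ∣[x]-cong (λ x → cong (Θ p ∘ _!) (sym (p^i*[p*x+a] x)))
    (Θ[p^j*x]!∣[x]Θ[p^j*x+K]! p (nonTrivial⇒n>1 p {{prime⇒nonTrivial p-prime}}) p-prime (i + 1) (p ^ i * a) p^i*a<p^[i+1])
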